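{- Let $d$ be a positive integer and let $P$ be a simple graph with $d+1$ vertices and minimum degree $d-2$ having at most $d-2$ vertices of degree exactly $d-2$. Let $A=\{v\in V(P):\deg(v)=d-2\}$ and $B=V(P)\setminus A$. If $P$ has three or more gadgets, then $P$ is a $d$-pod.
   Context: A missing edge of $P$ is a pair of distinct vertices of $P$ that are not adjacent in $P$ (an edge of the complement of $P$). A gadget of $P$ is either (1) a missing odd cycle in $A$, i.e. a cycle of odd length all of whose vertices lie in $A$ and all of whose edges are missing edges of $P$; or (2) a missing path of length 2 with end vertices in $B$ and middle vertex in $A$, i.e. vertices $b,a,b'$ with $b,b'\in B$ distinct, $a\in A$, and $ba$, $ab'$ missing edges of $P$. A graph $H$ is immersed in a multigraph $G$ if there is an injection $\phi:V(H)\to V(G)$ and an assignment to each edge $uv\in E(H)$ of a path in $G$ between $\phi(u)$ and $\phi(v)$ with paths of distinct edges pairwise edge-disjoint. A $d$-pod is a simple graph in which every vertex has degree at least $d-2$ and at most $d-2$ vertices have degree exactly $d-2$, and such that, letting $A$ be its set of vertices of degree exactly $d-2$, for every maximum matching on $A$ (i.e. $\lfloor |A|/2\rfloor$ pairwise disjoint pairs of vertices of $A$), the multigraph obtained by adding one new edge joining each chosen pair (parallel edges allowed) has no immersion of $K_d$. -}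

module Defs where

open import Data.Nat using (ℕ; zero; suc; _∸_; _≤_; _<_; _≡ᵇ_; _<ᵇ_; _/_; _%_)
open import Data.Bool using (Bool; true; false; _∧_)
open import Data.Fin using (Fin; toℕ; inject₁; fromℕ) renaming (zero to fzero; suc to fsuc)
open import Data.List using (List; []; _∷_; _++_; length; filterᵇ; allFin; concatMap; map; lookup)
open import Data.List.Relation.Unary.All using (All)
open import Data.List.Relation.Unary.Unique.Propositional using (Unique)
open import Data.Product using (Σ; ∃; ∃-syntax; _×_; _,_; proj₁; proj₂)
open import Data.Sum using (_⊎_)
open import Relation.Binary.PropositionalEquality using (_≡_; _≢_)
open import Relation.Nullary using (¬_)
open import Function.Definitions using (Injective)
open import Function.Bundles using (_⇔_)
open import Level using (0ℓ)

record SimpleGraph (n : ℕ) : Set where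
  field
    Adj   : Fin n → Fin n → Bool
    sym   : ∀ u v → Adj u v ≡ Adj v u
    irrefl : ∀ v → Adj v v ≡ false
open SimpleGraph public

module _ {n : ℕ} (P : SimpleGraph n) where

  deg : Fin n → ℕ
  deg v = length (filterᵇ (Adj P v) (allFin n))

  Missing : Fin n → Fin n → Set
  Missing u v = u ≢ v × Adj P u v ≡ false

-- `Link a b u w` : the unordered pair {a,b} equals {u,w}
Link : {n : ℕ} → Fin n → Fin n → Fin n → Fin n → Set
Link a b u w = (a ≡ u × b ≡ w) ⊎ (a ≡ w × b ≡ u)

EdgeSet : ℕ → Set₁
EdgeSet n = Fin n → Fin n → Set

SameEdgeSet : {n : ℕ} → EdgeSet n → EdgeSet n → Set
SameEdgeSet E F = ∀ u w → E u w ⇔ F u w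

-- Cycles: a cycle of length (suc m) given by vertices v 0, …, v m,
-- with edges v i – v (i+1) (i < m) and the closing edge v m – v 0.

record Cycle (n : ℕ) : Set where
  field
    m     : ℕ
    verts : Fin (suc m) → Fin n
    inj   : Injective _≡_ _≡_ verts
open Cycle public

cycLength : {n : ℕ} → Cycle n → ℕ
cycLength c = suc (m c)

CycleEdge : {n : ℕ} → Cycle n → EdgeSet n
CycleEdge c u w =
  (∃[ i ] Link (verts c (inject₁ i)) (verts c (fsuc i)) u w)
  ⊎ Link (verts c (fromℕ (m c))) (verts c fzero) u w

module _ {n : ℕ} (d : ℕ) (P : SimpleGraph n) where

  InA : Fin n → Set
  InA v = deg P v ≡ d ∸ 2

  InB : Fin n → Set
  InB v = ¬ InA v

  sizeA : ℕ
  sizeA = length (filterᵇ (λ v → deg P v ≡ᵇ (d ∸ 2)) (allFin n))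

  MissingOddCycleInA : Cycle n → Set
  MissingOddCycleInA c =
    3 ≤ cycLength c × cycLength c % 2 ≡ 1
    × (∀ i → InA (verts c i))
    × (∀ u w → CycleEdge c u w → Missing P u w)

  -- a gadget, identified with its edge set
  IsGadget : EdgeSet n → Set
  IsGadget E =
    (∃[ c ] MissingOddCycleInA c × SameEdgeSet E (CycleEdge c))
    ⊎ (∃[ b ] ∃[ a ] ∃[ b' ] InB b × InB b' × b ≢ b' × InA a
         × Missing P b a × Missing P a b'
         × SameEdgeSet E (λ u w → Link b a u w ⊎ Link a b' u w))

  AtLeastThreeGadgets : Set₁
  AtLeastThreeGadgets =
    Σ (EdgeSet n) λ E₁ → Σ (EdgeSet n) λ E₂ → Σ (EdgeSet n) λ E₃ →
      IsGadget E₁ × IsGadget E₂ × IsGadget E₃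
      × ¬ SameEdgeSet E₁ E₂ × ¬ SameEdgeSet E₁ E₃ × ¬ SameEdgeSet E₂ E₃

-- Multigraphs (parallel edges allowed) on vertex set Fin n, given by a
-- list of edges (pairs of end vertices).

Multigraph : ℕ → Set
Multigraph n = List (Fin n × Fin n)

module _ {n : ℕ} (G : Multigraph n) where

  EdgeId : Set
  EdgeId = Fin (length G)

  record Path (x y : Fin n) : Set where
    field
      len   : ℕ
      pv    : Fin (suc len) → Fin n
      pvInj : Injective _≡_ _≡_ pv
      start : pv fzero ≡ x
      end   : pv (fromℕ len) ≡ y
      pe    : Fin len → EdgeId
      pEnds : ∀ i → Link (proj₁ (lookup G (pe i))) (proj₂ (lookup G (pe i)))
                         (pv (inject₁ i)) (pv (fsuc i))
  open Path public

  record KImmersion (d : ℕ) : Set where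
    field
      φ      : Fin d → Fin n
      φInj   : Injective _≡_ _≡_ φ
      route  : (i j : Fin d) → toℕ i < toℕ j → Path (φ i) (φ j)
      disj   : ∀ i j (p : toℕ i < toℕ j) i' j' (p' : toℕ i' < toℕ j')
               → ¬ (i ≡ i' × j ≡ j')
               → ∀ k k' → pe (route i j p) k ≢ pe (route i' j' p') k'

allPairs : (n : ℕ) → List (Fin n × Fin n)
allPairs n = concatMap (λ u → map (u ,_) (allFin n)) (allFin n)

edgeList : {n : ℕ} → SimpleGraph n → Multigraph n
edgeList {n} P = filterᵇ (λ p → Adj P (proj₁ p) (proj₂ p) ∧ (toℕ (proj₁ p) <ᵇ toℕ (proj₂ p))) (allPairs n)

module _ {n : ℕ} (d : ℕ) (P : SimpleGraph n) where

  MaxMatchingOnA : List (Fin n × Fin n) → Set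
  MaxMatchingOnA M =
    All (λ p → InA d P (proj₁ p) × InA d P (proj₂ p) × proj₁ p ≢ proj₂ p) M
    × Unique (concatMap (λ p → proj₁ p ∷ proj₂ p ∷ []) M)
    × length M ≡ sizeA d P / 2

  IsDPod : Set
  IsDPod =
    (∀ v → d ∸ 2 ≤ deg P v)
    × sizeA d P ≤ d ∸ 2
    × (∀ M → MaxMatchingOnA M → ¬ KImmersion (edgeList P ++ M) d)

module Submission where

-- For d ≤ 2 the hypotheses are contradictory (A is nonempty, |A| ≤ d-2 = 0),
-- so let d ≥ 3.  Fix a maximum matching M on A, put G = P + M, and suppose
-- K_d immerses in G with branch map φ.  In P + M
--     only matching edges can be parallel to other edges, and every vertex
--     meets at most |V|-1 edges provided every matched vertex has a missing
--     neighbour in P.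
--  2. Immersions of K_d in P + M on d+1 vertices: counting edges at a branch
--     vertex shows that no route passes through a branch vertex, so the only
--     interior vertex a route can have is the unique non-branch vertex z.
--     Hence a branch vertex non-adjacent in G to two other branch vertices is
--     joined to z by two distinct G-edges, so it is the M-partner of z.
--  3. Local structure of P: each vertex of A has exactly two missing
--     neighbours, so two gadgets sharing a vertex of A coincide.
--  4. Every gadget contains z or the M-partner of z (for a missing odd cycle
--     this is a parity argument).  Three distinct gadgets would give two of
--     them sharing such a vertex, contradicting step 3.

open import Defs hiding (sym)
open import Data.Nat using (ℕ; zero; suc; _+_; _*_; _∸_; _≤_; _<_; _≡ᵇ_; _<ᵇ_; _%_; _/_; z≤n; s≤s)
import Data.Nat.Properties as ℕP
import Data.Nat.DivMod as DM
open import Data.Bool using (Bool; true; false; not; _∧_; T)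
open import Data.Bool.Properties using (T?; T-∧; T-≡; T-not-≡)
open import Data.Fin using (Fin; toℕ; fromℕ; fromℕ<; inject₁; punchIn; punchOut) renaming (zero to fzero; suc to fsuc)
import Data.Fin.Properties as FP
open import Data.List using (List; []; _∷_; _++_; length; lookup; filterᵇ; allFin; concatMap; map; cartesianProduct)
import Data.List.Properties as LP
open import Data.List.Relation.Unary.All using (All; []; _∷_)
import Data.List.Relation.Unary.All as All
import Data.List.Relation.Unary.All.Properties as AllP
open import Data.List.Relation.Unary.Any using (index)
open import Data.List.Relation.Unary.Any.Properties using (lookup-index)
open import Data.List.Membership.Propositional using (_∈_)
import Data.List.Membership.Propositional.Properties as MP
open import Data.List.Relation.Unary.AllPairs using ([]; _∷_)
open import Data.List.Relation.Unary.Unique.Propositional using (Unique)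
import Data.List.Relation.Unary.Unique.Propositional.Properties as UP
open import Data.Product using (Σ; ∃-syntax; _×_; _,_; proj₁; proj₂)
open import Data.Sum using (_⊎_; inj₁; inj₂; [_,_]′)
open import Data.Empty using (⊥; ⊥-elim)
open import Function.Definitions using (Injective)
open import Function.Bundles using (mk⇔; Equivalence)
open import Relation.Nullary using (¬_; Dec; yes; no; does; ¬?)
open import Relation.Nullary.Decidable using (_×-dec_; _⊎-dec_)
open import Relation.Binary.Definitions using (tri<; tri≈; tri>)
open import Relation.Binary.PropositionalEquality

private variable
  n : ℕ
  A : Set
  p q u w u' w' : Fin n

link-swap : Link p q u w → Link p q w u
link-swap (inj₁ (e₁ , e₂)) = inj₂ (e₁ , e₂)
link-swap (inj₂ (e₁ , e₂)) = inj₁ (e₁ , e₂)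

link-flip : Link p q u w → Link q p u w
link-flip (inj₁ (e₁ , e₂)) = inj₂ (e₂ , e₁)
link-flip (inj₂ (e₁ , e₂)) = inj₁ (e₂ , e₁)

link-sym : Link p q u w → Link u w p q
link-sym (inj₁ (e₁ , e₂)) = inj₁ (sym e₁ , sym e₂)
link-sym (inj₂ (e₁ , e₂)) = inj₂ (sym e₂ , sym e₁)

link-trans : Link p q u w → Link u w u' w' → Link p q u' w'
link-trans (inj₁ (refl , refl)) l = l
link-trans (inj₂ (refl , refl)) l = link-flip l

link-cases : Link p q u w → Link p q u' w' → (u ≡ u' × w ≡ w') ⊎ (u ≡ w' × w ≡ u')
link-cases l l' = link-trans (link-sym l) l'

link-partner : p ≢ q → Link p q u w → Link p q u' w → u ≡ u'
link-partner p≢q (inj₁ (refl , _)) (inj₁ (refl , _)) = refl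
link-partner p≢q (inj₁ (_ , refl)) (inj₂ (refl , _)) = ⊥-elim (p≢q refl)
link-partner p≢q (inj₂ (refl , _)) (inj₁ (_ , refl)) = ⊥-elim (p≢q refl)
link-partner p≢q (inj₂ (_ , refl)) (inj₂ (_ , refl)) = refl

link-end₁ : Link p q u w → p ≡ u ⊎ q ≡ u
link-end₁ (inj₁ (e , _)) = inj₁ e
link-end₁ (inj₂ (_ , e)) = inj₂ e

link-end₂ : Link p q u w → p ≡ w ⊎ q ≡ w
link-end₂ (inj₁ (_ , e)) = inj₂ e
link-end₂ (inj₂ (e , _)) = inj₁ e

link? : (p q u w : Fin n) → Dec (Link p q u w)
link? p q u w = ((p FP.≟ u) ×-dec (q FP.≟ w)) ⊎-dec ((p FP.≟ w) ×-dec (q FP.≟ u))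

same-edge-set : {E E' F F' : EdgeSet n} → SameEdgeSet E F → SameEdgeSet E' F' →
  (∀ u w → F u w → F' u w) → (∀ u w → F' u w → F u w) → SameEdgeSet E E'
same-edge-set E≈F E'≈F' to from u w =
  mk⇔ (λ x → Equivalence.from (E'≈F' u w) (to u w (Equivalence.to (E≈F u w) x)))
      (λ x → Equivalence.from (E≈F u w) (from u w (Equivalence.to (E'≈F' u w) x)))

Incident : Fin n × Fin n → Fin n → Set
Incident e y = proj₁ e ≡ y ⊎ proj₂ e ≡ y

Joins : Fin n × Fin n → Fin n → Fin n → Set
Joins e u w = Link (proj₁ e) (proj₂ e) u w

incident? : (e : Fin n × Fin n) (y : Fin n) → Dec (Incident e y)
incident? e y = (proj₁ e FP.≟ y) ⊎-dec (proj₂ e FP.≟ y)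

∈⇒nonempty : {x : A} {xs : List A} → x ∈ xs → 1 ≤ length xs
∈⇒nonempty {xs = _ ∷ _} _ = s≤s z≤n

lookup-All : {Q : A → Set} {xs : List A} → All Q xs → ∀ i → Q (lookup xs i)
lookup-All qs i = All.lookup qs (MP.∈-lookup i)

lookup-injective : {xs : List A} → Unique xs → Injective _≡_ _≡_ (lookup xs)
lookup-injective {xs = _ ∷ _} _          {fzero}  {fzero}  _ = refl
lookup-injective {xs = _ ∷ _} (x∉ ∷ _)   {fzero}  {fsuc j} e = ⊥-elim (lookup-All x∉ j e)
lookup-injective {xs = _ ∷ _} (x∉ ∷ _)   {fsuc i} {fzero}  e = ⊥-elim (lookup-All x∉ i (sym e))
lookup-injective {xs = _ ∷ _} (_ ∷ uniq) {fsuc i} {fsuc j} e = cong fsuc (lookup-injective uniq e)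

unique-⊆-length : {xs ys : List A} → Unique xs → All (_∈ ys) xs → length xs ≤ length ys
unique-⊆-length {xs = xs} {ys} uniq sub = FP.injective⇒≤ {f = position} position-injective
  where
  position : Fin (length xs) → Fin (length ys)
  position i = index (lookup-All sub i)
  at-position : ∀ i → lookup ys (position i) ≡ lookup xs i
  at-position i = sym (lookup-index (lookup-All sub i))
  position-injective : Injective _≡_ _≡_ position
  position-injective {i} {j} e = lookup-injective uniq
    (trans (sym (at-position i)) (trans (cong (lookup ys) e) (at-position j)))

another-member : {Q : A → Set} (xs : List A) → Unique xs → All Q xs → 2 ≤ length xs →
  (y : A) → (∀ a → Dec (a ≡ y)) → ∃[ x ] (x ≢ y × Q x)
another-member (a ∷ []) _ _ (s≤s ()) _ _
another-member (a ∷ b ∷ _) ((a≢b ∷ _) ∷ _) (qa ∷ qb ∷ _) _ y _≟y with a ≟y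
... | no a≢y = a , a≢y , qa
... | yes a≡y = b , (λ b≡y → a≢b (trans a≡y (sym b≡y))) , qb

length-filter-split : (b : A → Bool) (xs : List A) →
  length (filterᵇ b xs) + length (filterᵇ (λ x → not (b x)) xs) ≡ length xs
length-filter-split b [] = refl
length-filter-split b (x ∷ xs) with b x
... | true  = cong suc (length-filter-split b xs)
... | false = trans (ℕP.+-suc _ _) (cong suc (length-filter-split b xs))

inl-index : (xs ys : List A) → Fin (length xs) → Fin (length (xs ++ ys))
inl-index (x ∷ xs) ys fzero    = fzero
inl-index (x ∷ xs) ys (fsuc j) = fsuc (inl-index xs ys j)

inr-index : (xs ys : List A) → Fin (length ys) → Fin (length (xs ++ ys))
inr-index []       ys j = j
inr-index (x ∷ xs) ys j = fsuc (inr-index xs ys j)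

data AppendView {A : Set} (xs ys : List A) : Fin (length (xs ++ ys)) → Set where
  left  : (j : Fin (length xs)) → AppendView xs ys (inl-index xs ys j)
  right : (j : Fin (length ys)) → AppendView xs ys (inr-index xs ys j)

append-view : (xs ys : List A) (e : Fin (length (xs ++ ys))) → AppendView xs ys e
append-view []       ys e        = right e
append-view (x ∷ xs) ys fzero    = left fzero
append-view (x ∷ xs) ys (fsuc e) with append-view xs ys e
... | left j  = left (fsuc j)
... | right j = right j

lookup-inl : (xs ys : List A) (j : Fin (length xs)) → lookup (xs ++ ys) (inl-index xs ys j) ≡ lookup xs j
lookup-inl (x ∷ xs) ys fzero    = refl
lookup-inl (x ∷ xs) ys (fsuc j) = lookup-inl xs ys j

lookup-inr : (xs ys : List A) (j : Fin (length ys)) → lookup (xs ++ ys) (inr-index xs ys j) ≡ lookup ys j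
lookup-inr []       ys j = refl
lookup-inr (x ∷ xs) ys j = lookup-inr xs ys j

no-injection : ∀ {m} (f : Fin (suc m) → Fin m) → Injective _≡_ _≡_ f → ⊥
no-injection {m} f f-inj = ℕP.<-irrefl refl (FP.injective⇒≤ {f = f} f-inj)

data LastOrInner : {m : ℕ} → Fin (suc m) → Set where
  last  : ∀ {m} → LastOrInner (fromℕ m)
  inner : ∀ {m} (i : Fin m) → LastOrInner (inject₁ i)

last-or-inner : ∀ {m} (i : Fin (suc m)) → LastOrInner i
last-or-inner {zero}  fzero    = last
last-or-inner {suc m} fzero    = inner fzero
last-or-inner {suc m} (fsuc i) with last-or-inner i
... | last    = last
... | inner j = inner (fsuc j)

true≢false : true ≢ false
true≢false ()

flips : ℕ → Bool → Bool
flips zero    b = b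
flips (suc x) b = not (flips x b)

flips-even : ∀ h b → flips (h * 2) b ≡ b
flips-even zero    b = refl
flips-even (suc h) b with flips (h * 2) b | flips-even h b
... | true  | e = e
... | false | e = e

not-fixed : ∀ b → b ≢ not b
not-fixed true  ()
not-fixed false ()

no-odd-alternation : {Q : ℕ → Set} → (∀ x → Dec (Q x)) → ∀ L → L % 2 ≡ 1 →
  (∀ x → x < L → Q x ⊎ Q (suc x)) → (∀ x → Q x → Q (suc x) → ⊥) → (Q L → Q 0) → (Q 0 → Q L) → ⊥
no-odd-alternation {Q} Q? L odd one-of never-both L→0 0→L =
  not-fixed (bit 0) (begin
    bit 0                       ≡⟨ sym periodic ⟩
    bit L                       ≡⟨ alternating L ℕP.≤-refl ⟩
    flips L (bit 0)             ≡⟨ cong (λ y → flips y (bit 0)) L-odd ⟩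
    not (flips (h * 2) (bit 0)) ≡⟨ cong not (flips-even h (bit 0)) ⟩
    not (bit 0)                 ∎)
  where
  open ≡-Reasoning
  bit : ℕ → Bool
  bit x = does (Q? x)
  h : ℕ
  h = L / 2
  L-odd : L ≡ suc (h * 2)
  L-odd = trans (DM.m≡m%n+[m/n]*n L 2) (cong (_+ h * 2) odd)
  flip : ∀ x → x < L → bit (suc x) ≡ not (bit x)
  flip x x<L with Q? x | Q? (suc x) | one-of x x<L
  ... | yes q  | yes q' | _       = ⊥-elim (never-both x q q')
  ... | yes _  | no _   | _       = refl
  ... | no _   | yes _  | _       = refl
  ... | no ¬q  | no _   | inj₁ q  = ⊥-elim (¬q q)
  ... | no _   | no ¬q' | inj₂ q' = ⊥-elim (¬q' q')
  alternating : ∀ x → x ≤ L → bit x ≡ flips x (bit 0)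
  alternating zero    _   = refl
  alternating (suc x) x<L = trans (flip x x<L) (cong not (alternating x (ℕP.<⇒≤ x<L)))
  periodic : bit L ≡ bit 0
  periodic with Q? L | Q? 0
  ... | yes _  | yes _  = refl
  ... | yes qL | no ¬q0 = ⊥-elim (¬q0 (L→0 qL))
  ... | no ¬qL | yes q0 = ⊥-elim (¬qL (0→L q0))
  ... | no _   | no _   = refl

NoEdge : Multigraph n → Fin n → Fin n → Set
NoEdge G u w = ∀ e → ¬ Joins (lookup G e) u w

no-edge-sym : {G : Multigraph n} → NoEdge G u w → NoEdge G w u
no-edge-sym none e l = none e (link-swap l)

module _ {n : ℕ} {G : Multigraph n} where

  -- A path uses each of its edges once, because its vertices are distinct.
  path-edges-distinct : ∀ {x y} (r : Path G x y) → Injective _≡_ _≡_ (Path.pe r)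
  path-edges-distinct r {a} {b} same
    with link-cases (Path.pEnds r a) (subst (λ e → Joins (lookup G e) _ _) (sym same) (Path.pEnds r b))
  ... | inj₁ (e₁ , _)  = FP.inject₁-injective (Path.pvInj r e₁)
  ... | inj₂ (e₁ , e₂) = ⊥-elim (ℕP.<-asym b<a a<b)
    where
    b<a : toℕ b < toℕ a
    b<a = ℕP.≤-reflexive (trans (sym (cong toℕ (Path.pvInj r e₁))) (FP.toℕ-inject₁ a))
    a<b : toℕ a < toℕ b
    a<b = ℕP.≤-reflexive (trans (cong toℕ (Path.pvInj r e₂)) (FP.toℕ-inject₁ b))

  first-edge : ∀ {x y} (r : Path G x y) → x ≢ y → Σ (Fin (Path.len r)) λ i → Incident (lookup G (Path.pe r i)) x
  first-edge record { len = zero ; start = st ; end = en } x≢y = ⊥-elim (x≢y (trans (sym st) en))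
  first-edge record { len = suc l ; pEnds = ends ; start = st } _ =
    fzero , subst (Incident _) st (link-end₁ (ends fzero))

  last-edge : ∀ {x y} (r : Path G x y) → x ≢ y → Σ (Fin (Path.len r)) λ i → Incident (lookup G (Path.pe r i)) y
  last-edge record { len = zero ; start = st ; end = en } x≢y = ⊥-elim (x≢y (trans (sym st) en))
  last-edge record { len = suc l ; pEnds = ends ; end = en } _ =
    fromℕ l , subst (Incident _) en (link-end₂ (ends (fromℕ l)))

  record Interior {x y} (r : Path G x y) : Set where
    field
      v       : Fin n
      k₁ k₂   : Fin (Path.len r)
      k₁≢k₂   : k₁ ≢ k₂
      k₁-at-v : Incident (lookup G (Path.pe r k₁)) v
      k₂-at-v : Incident (lookup G (Path.pe r k₂)) v
      v≢x     : v ≢ x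
      v≢y     : v ≢ y

  interior-before-end : ∀ {x y} (r : Path G x y) → x ≢ y → NoEdge G x y →
    Σ (Interior r) λ I → Joins (lookup G (Path.pe r (Interior.k₂ I))) (Interior.v I) y
  interior-before-end record { len = zero ; start = st ; end = en } x≢y _ = ⊥-elim (x≢y (trans (sym st) en))
  interior-before-end record { len = suc zero ; pEnds = ends ; start = st ; end = en } _ no-xy =
    ⊥-elim (no-xy _ (subst₂ (Joins _) st en (ends fzero)))
  interior-before-end record { len = suc (suc l) ; pv = pv ; pvInj = pv-inj ; pEnds = ends ; start = st ; end = en } _ _ =
    record { v = pv (fsuc (inject₁ (fromℕ l))) ; k₁ = inject₁ (fromℕ l) ; k₂ = fromℕ (suc l)
           ; k₁≢k₂ = λ e → FP.fromℕ≢inject₁ (sym e)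
           ; k₁-at-v = link-end₂ (ends (inject₁ (fromℕ l)))
           ; k₂-at-v = link-end₁ (ends (fromℕ (suc l)))
           ; v≢x = λ e → FP.0≢1+n (sym (pv-inj (trans e (sym st))))
           ; v≢y = λ e → FP.fromℕ≢inject₁ (sym (pv-inj (trans e (sym en)))) }
    , subst (Joins _ _) en (ends (fromℕ (suc l)))

  interior-after-start : ∀ {x y} (r : Path G x y) → x ≢ y → NoEdge G x y →
    Σ (Interior r) λ I → Joins (lookup G (Path.pe r (Interior.k₁ I))) x (Interior.v I)
  interior-after-start record { len = zero ; start = st ; end = en } x≢y _ = ⊥-elim (x≢y (trans (sym st) en))
  interior-after-start record { len = suc zero ; pEnds = ends ; start = st ; end = en } _ no-xy =
    ⊥-elim (no-xy _ (subst₂ (Joins _) st en (ends fzero)))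
  interior-after-start record { len = suc (suc l) ; pv = pv ; pvInj = pv-inj ; pEnds = ends ; start = st ; end = en } _ _ =
    record { v = pv (fsuc fzero) ; k₁ = fzero ; k₂ = fsuc fzero
           ; k₁≢k₂ = λ ()
           ; k₁-at-v = link-end₂ (ends fzero)
           ; k₂-at-v = link-end₁ (ends (fsuc fzero))
           ; v≢x = λ e → FP.0≢1+n (sym (pv-inj (trans e (sym st))))
           ; v≢y = λ e → FP.fromℕ≢inject₁ (sym (pv-inj (trans e (sym en)))) }
    , subst (λ a → Joins _ a _) st (ends fzero)

module SimpleGraphFacts {n : ℕ} (P : SimpleGraph n) where

  missing-sym : ∀ {u w} → Missing P u w → Missing P w u
  missing-sym (u≢w , no-uw) = (λ e → u≢w (sym e)) , trans (SimpleGraph.sym P _ _) no-uw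

  private
    EL : Multigraph n
    EL = edgeList P

    listed? : Fin n × Fin n → Bool
    listed? e = Adj P (proj₁ e) (proj₂ e) ∧ (toℕ (proj₁ e) <ᵇ toℕ (proj₂ e))

    listed : ∀ j → T (listed? (lookup EL j))
    listed = lookup-All (AllP.all-filter (λ e → T? (listed? e)) (allPairs n))

    allPairs≡product : ∀ (xs ys : List (Fin n)) → concatMap (λ u → map (u ,_) ys) xs ≡ cartesianProduct xs ys
    allPairs≡product []       ys = refl
    allPairs≡product (x ∷ xs) ys = cong (map (x ,_) ys ++_) (allPairs≡product xs ys)

  edgeList-adj : ∀ j → Adj P (proj₁ (lookup EL j)) (proj₂ (lookup EL j)) ≡ true
  edgeList-adj j = Equivalence.to T-≡ (proj₁ (Equivalence.to T-∧ (listed j)))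

  edgeList-ordered : ∀ j → toℕ (proj₁ (lookup EL j)) < toℕ (proj₂ (lookup EL j))
  edgeList-ordered j = ℕP.<ᵇ⇒< _ _ (proj₂ (Equivalence.to T-∧ (listed j)))

  edgeList-unique : Unique EL
  edgeList-unique = UP.filter⁺ (λ e → T? (listed? e))
    (subst Unique (sym (allPairs≡product (allFin n) (allFin n)))
      (UP.cartesianProduct⁺ (UP.allFin⁺ n) (UP.allFin⁺ n)))

  -- Each pair of vertices is listed at most once (pairs are listed in increasing order).
  edgeList-simple : ∀ j j' {u w} → Joins (lookup EL j) u w → Joins (lookup EL j') u w → j ≡ j'
  edgeList-simple j j' l l' = lookup-injective edgeList-unique
    (same-pair (edgeList-ordered j) (edgeList-ordered j') l l')
    where
    same-pair : ∀ {p q p' q' u w : Fin n} → toℕ p < toℕ q → toℕ p' < toℕ q' →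
                Link p q u w → Link p' q' u w → (p , q) ≡ (p' , q')
    same-pair _  _   (inj₁ (refl , refl)) (inj₁ (refl , refl)) = refl
    same-pair lt lt' (inj₁ (refl , refl)) (inj₂ (refl , refl)) = ⊥-elim (ℕP.<-asym lt lt')
    same-pair lt lt' (inj₂ (refl , refl)) (inj₁ (refl , refl)) = ⊥-elim (ℕP.<-asym lt lt')
    same-pair _  _   (inj₂ (refl , refl)) (inj₂ (refl , refl)) = refl

  -- The vertices not adjacent to y, y itself included.
  nonNeighbours : Fin n → List (Fin n)
  nonNeighbours y = filterᵇ (λ x → not (Adj P y x)) (allFin n)

  deg+nonNeighbours : ∀ y → deg P y + length (nonNeighbours y) ≡ n
  deg+nonNeighbours y = trans (length-filter-split (Adj P y) (allFin n)) (LP.length-tabulate (λ x → x))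

  nonNeighbours-unique : ∀ y → Unique (nonNeighbours y)
  nonNeighbours-unique y = UP.filter⁺ (λ x → T? (not (Adj P y x))) (UP.allFin⁺ n)

  nonNeighbours-nonadjacent : ∀ y → All (λ x → Adj P y x ≡ false) (nonNeighbours y)
  nonNeighbours-nonadjacent y =
    All.map (Equivalence.to T-not-≡) (AllP.all-filter (λ x → T? (not (Adj P y x))) (allFin n))

  ∈-nonNeighbours : ∀ y {x} → Adj P y x ≡ false → x ∈ nonNeighbours y
  ∈-nonNeighbours y {x} no-yx =
    MP.∈-filter⁺ (λ x → T? (not (Adj P y x))) (MP.∈-allFin x) (Equivalence.from T-not-≡ no-yx)

endpoints : List (Fin n × Fin n) → List (Fin n)
endpoints = concatMap (λ e → proj₁ e ∷ proj₂ e ∷ [])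

endpoints-All : {Q : Fin n → Set} (M : List (Fin n × Fin n)) → All Q (endpoints M) →
  ∀ j {y} → Incident (lookup M j) y → Q y
endpoints-All (e ∷ M) (q₁ ∷ q₂ ∷ _)  fzero    (inj₁ refl) = q₁
endpoints-All (e ∷ M) (q₁ ∷ q₂ ∷ _)  fzero    (inj₂ refl) = q₂
endpoints-All (e ∷ M) (_ ∷ _ ∷ qs)   (fsuc j) inc         = endpoints-All M qs j inc

matched-once : (M : List (Fin n × Fin n)) → Unique (endpoints M) →
  ∀ i j {y} → Incident (lookup M i) y → Incident (lookup M j) y → i ≡ j
matched-once (e ∷ M) _               fzero    fzero    _          _          = refl
matched-once (e ∷ M) (a₁ ∷ a₂ ∷ _)   fzero    (fsuc j) (inj₁ refl) inc       = ⊥-elim (endpoints-All M (All.tail a₁) j inc refl)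
matched-once (e ∷ M) (a₁ ∷ a₂ ∷ _)   fzero    (fsuc j) (inj₂ refl) inc       = ⊥-elim (endpoints-All M a₂ j inc refl)
matched-once (e ∷ M) (a₁ ∷ a₂ ∷ _)   (fsuc i) fzero    inc        (inj₁ refl) = ⊥-elim (endpoints-All M (All.tail a₁) i inc refl)
matched-once (e ∷ M) (a₁ ∷ a₂ ∷ _)   (fsuc i) fzero    inc        (inj₂ refl) = ⊥-elim (endpoints-All M a₂ i inc refl)
matched-once (e ∷ M) (_ ∷ _ ∷ uniq)  (fsuc i) (fsuc j) inc        inc'       = cong fsuc (matched-once M uniq i j inc inc')

matching-partner : (M : List (Fin n × Fin n)) → Unique (endpoints M) → All (λ e → proj₁ e ≢ proj₂ e) M →
  ∀ i j {a a' z} → Joins (lookup M i) a z → Joins (lookup M j) a' z → a ≡ a'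
matching-partner M uniq proper i j l l' with matched-once M uniq i j (link-end₂ l) (link-end₂ l')
... | refl = link-partner (lookup-All proper i) l l'

module CyclicWalk {n : ℕ} (c : Cycle n) where

  L : ℕ
  L = cycLength c

  walk : ℕ → Fin n
  walk x = verts c (fromℕ< (DM.m%n<n x L))

  walk-mod : ∀ x y → x % L ≡ y % L → walk x ≡ walk y
  walk-mod x y e = cong (verts c) (FP.fromℕ<-cong _ _ e (DM.m%n<n x L) (DM.m%n<n y L))

  walk-mod⁻¹ : ∀ x y → walk x ≡ walk y → x % L ≡ y % L
  walk-mod⁻¹ x y e = trans (sym (FP.toℕ-fromℕ< (DM.m%n<n x L)))
    (trans (cong toℕ (inj c e)) (FP.toℕ-fromℕ< (DM.m%n<n y L)))

  walk-period : ∀ x → walk (x + L) ≡ walk x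
  walk-period x = walk-mod (x + L) x (DM.[m+n]%n≡m%n x L)

  walk-% : ∀ x → walk (x % L) ≡ walk x
  walk-% x = walk-mod (x % L) x (DM.m%n%n≡m%n x L)

  %-suc : ∀ x → suc x % L ≡ suc (x % L) % L
  %-suc x = trans (cong (λ y → suc y % L) (DM.m≡m%n+[m/n]*n x L)) (DM.[m+kn]%n≡m%n (suc (x % L)) (x / L) L)

  walk-suc-% : ∀ x → walk (suc (x % L)) ≡ walk (suc x)
  walk-suc-% x = walk-mod (suc (x % L)) (suc x) (sym (%-suc x))

  walk-toℕ : ∀ i → walk (toℕ i) ≡ verts c i
  walk-toℕ i = cong (verts c) (FP.toℕ-injective (trans (FP.toℕ-fromℕ< (DM.m%n<n (toℕ i) L)) (DM.m<n⇒m%n≡m (FP.toℕ<n i))))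

  cycleEdge→step : ∀ {u w} → CycleEdge c u w → ∃[ x ] Link (walk x) (walk (suc x)) u w
  cycleEdge→step (inj₁ (i , l)) = toℕ i ,
    subst₂ (λ a b → Link a b _ _) (sym (trans (cong walk (sym (FP.toℕ-inject₁ i))) (walk-toℕ (inject₁ i))))
      (sym (walk-toℕ (fsuc i))) l
  cycleEdge→step (inj₂ l) = m c ,
    subst₂ (λ a b → Link a b _ _) (sym (trans (cong walk (sym (FP.toℕ-fromℕ (m c)))) (walk-toℕ (fromℕ (m c)))))
      (sym (trans (walk-period 0) (walk-toℕ fzero))) l

  step→cycleEdge : ∀ x {u w} → Link (walk x) (walk (suc x)) u w → CycleEdge c u w
  step→cycleEdge x {u} {w} l = at (fromℕ< x%L<L)
    (subst₂ (λ a b → Link a b u w)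
      (sym (trans (cong walk (FP.toℕ-fromℕ< x%L<L)) (walk-% x)))
      (sym (trans (cong (λ y → walk (suc y)) (FP.toℕ-fromℕ< x%L<L)) (walk-suc-% x))) l)
    where
    x%L<L : x % L < L
    x%L<L = DM.m%n<n x L
    at : (i : Fin L) → Link (walk (toℕ i)) (walk (suc (toℕ i))) u w → CycleEdge c u w
    at i l with last-or-inner i
    ... | last = inj₂ (subst₂ (λ a b → Link a b u w) (walk-toℕ (fromℕ (m c)))
                  (trans (cong (λ y → walk (suc y)) (FP.toℕ-fromℕ (m c))) (trans (walk-period 0) (walk-toℕ fzero))) l)
    ... | inner j = inj₁ (j , subst₂ (λ a b → Link a b u w) (walk-toℕ (inject₁ j))
                  (trans (cong (λ y → walk (suc y)) (FP.toℕ-inject₁ j)) (walk-toℕ (fsuc j))) l)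

  walk-skip : 3 ≤ L → ∀ x → walk x ≢ walk (suc (suc x))
  walk-skip 3≤L x e = no-shift (x % L) (DM.m%n<n x L)
    (trans (walk-mod⁻¹ x (suc (suc x)) e)
      (trans (%-suc (suc x)) (trans (cong (λ y → suc y % L) (%-suc x)) (sym (%-suc (suc (x % L)))))))
    where
    L≢2 : L ≢ 2
    L≢2 e = ℕP.<-irrefl (sym e) 3≤L
    no-shift : ∀ r → r < L → r ≢ suc (suc r) % L
    no-shift r r<L r≡ with ℕP.<-cmp (suc (suc r)) L
    ... | tri< r+2<L _ _ = ℕP.<-irrefl (trans r≡ (DM.m<n⇒m%n≡m r+2<L)) (ℕP.m≤n⇒m≤1+n (ℕP.n<1+n r))
    ... | tri≈ _ r+2≡L _ = L≢2 (trans (sym r+2≡L) (cong (λ y → suc (suc y)) r≡0))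
      where
      r≡0 : r ≡ 0
      r≡0 = trans r≡ (trans (cong (_% L) r+2≡L) (DM.n%n≡0 L))
    ... | tri> _ _ L<r+2 = L≢2 (trans L≡r+1 (cong suc r≡1))
      where
      L≡r+1 : L ≡ suc r
      L≡r+1 = ℕP.≤-antisym (ℕP.<⇒≤pred L<r+2) r<L
      r≡1 : r ≡ 1
      r≡1 = trans r≡ (trans (cong (λ y → suc y % L) (sym L≡r+1)) (trans (DM.[m+n]%n≡m%n 1 L) (DM.m<n⇒m%n≡m (ℕP.≤-trans (s≤s (s≤s z≤n)) 3≤L))))

module PlusMatching {n : ℕ} (P : SimpleGraph (suc (suc n))) (M : Multigraph (suc (suc n)))
  (M-disjoint : Unique (endpoints M)) (M-proper : All (λ e → proj₁ e ≢ proj₂ e) M) where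

  open SimpleGraphFacts P

  V : Set
  V = Fin (suc (suc n))

  EL : Multigraph (suc (suc n))
  EL = edgeList P

  G : Multigraph (suc (suc n))
  G = EL ++ M

  via-P : ∀ j → lookup G (inl-index EL M j) ≡ lookup EL j
  via-P = lookup-inl EL M

  via-M : ∀ j → lookup G (inr-index EL M j) ≡ lookup M j
  via-M = lookup-inr EL M

  G-edge : ∀ e {u w} → Joins (lookup G e) u w → Adj P u w ≡ true ⊎ ∃[ j ] Joins (lookup M j) u w
  G-edge e l with append-view EL M e
  ... | right j = inj₂ (j , subst (λ x → Joins x _ _) (via-M j) l)
  ... | left j with subst (λ x → Joins x _ _) (via-P j) l
  ...   | inj₁ (refl , refl) = inj₁ (edgeList-adj j)
  ...   | inj₂ (refl , refl) = inj₁ (trans (SimpleGraph.sym P _ _) (edgeList-adj j))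

  parallel-edges : ∀ e e' {a z} → e ≢ e' → Joins (lookup G e) a z → Joins (lookup G e') a z →
    ∃[ j ] Joins (lookup M j) a z
  parallel-edges e e' e≢e' l l' with append-view EL M e | append-view EL M e'
  ... | right j | _        = j , subst (λ x → Joins x _ _) (via-M j) l
  ... | left j  | right j' = j' , subst (λ x → Joins x _ _) (via-M j') l'
  ... | left j  | left j'  = ⊥-elim (e≢e' (cong (inl-index EL M) (edgeList-simple j j'
          (subst (λ x → Joins x _ _) (via-P j) l) (subst (λ x → Joins x _ _) (via-P j') l'))))

  no-G-edge : ∀ {u w} → Adj P u w ≡ false → (∀ j → ¬ Joins (lookup M j) u w) → NoEdge G u w
  no-G-edge no-uw unpaired e l with G-edge e l
  ... | inj₁ uw = true≢false (trans (sym uw) no-uw)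
  ... | inj₂ (j , l') = unpaired j l'

  far-end : V → V × V → V
  far-end y e with proj₁ e FP.≟ y
  ... | yes _ = proj₂ e
  ... | no _  = proj₁ e

  far-end-joins : ∀ e {y} → Incident e y → Joins e y (far-end y e)
  far-end-joins e {y} inc with proj₁ e FP.≟ y | inc
  ... | yes e₁≡y | _          = inj₁ (e₁≡y , refl)
  ... | no e₁≢y  | inj₁ e₁≡y  = ⊥-elim (e₁≢y e₁≡y)
  ... | no _     | inj₂ e₂≡y  = inj₂ (refl , e₂≡y)

  far-end-adj : ∀ e {y} → Adj P (proj₁ e) (proj₂ e) ≡ true → Incident e y → Adj P y (far-end y e) ≡ true
  far-end-adj e adj inc with far-end-joins e inc
  ... | inj₁ (refl , eq) = trans (cong (Adj P (proj₁ e)) (sym eq)) adj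
  ... | inj₂ (eq , refl) = trans (cong (Adj P _) (sym eq)) (trans (SimpleGraph.sym P _ _) adj)

  -- The far ends of the edges of G at y (the other end of a P-edge,
  -- x₀ for the matching edge) are distinct and differ from y, so y meets at
  -- most |V| - 1 edges of G.
  module AtVertex (y x₀ : V) (x₀≢y : x₀ ≢ y) (x₀-missing : ∀ j → Incident (lookup M j) y → Adj P y x₀ ≡ false) where

    far : EdgeId G → V
    far e with append-view EL M e
    ... | left j  = far-end y (lookup EL j)
    ... | right _ = x₀

    far≢y : ∀ e → Incident (lookup G e) y → far e ≢ y
    far≢y e inc with append-view EL M e
    ... | right _ = x₀≢y
    ... | left j = λ far≡y → true≢false (trans (sym (far-end-adj (lookup EL j) (edgeList-adj j) inc-P))
                     (trans (cong (Adj P y) far≡y) (SimpleGraph.irrefl P y)))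
      where
      inc-P : Incident (lookup EL j) y
      inc-P = subst (λ x → Incident x y) (via-P j) inc

    -- A P-edge at y does not lead to x₀, which y misses when it is matched.
    P-edge-avoids-x₀ : ∀ j j' → Incident (lookup G (inl-index EL M j)) y → Incident (lookup G (inr-index EL M j')) y →
      far-end y (lookup EL j) ≢ x₀
    P-edge-avoids-x₀ j j' inc inc' same = true≢false
      (trans (sym (far-end-adj (lookup EL j) (edgeList-adj j) (subst (λ x → Incident x y) (via-P j) inc)))
        (trans (cong (Adj P y) same) (x₀-missing j' (subst (λ x → Incident x y) (via-M j') inc'))))

    far-injective : ∀ e e' → Incident (lookup G e) y → Incident (lookup G e') y → far e ≡ far e' → e ≡ e'
    far-injective e e' inc inc' same with append-view EL M e | append-view EL M e'
    ... | left j  | left j'  = cong (inl-index EL M) (edgeList-simple j j'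
            (far-end-joins (lookup EL j) (subst (λ x → Incident x y) (via-P j) inc))
            (subst (Joins (lookup EL j') y) (sym same) (far-end-joins (lookup EL j') (subst (λ x → Incident x y) (via-P j') inc'))))
    ... | right j | right j' = cong (inr-index EL M)
            (matched-once M M-disjoint j j' (subst (λ x → Incident x y) (via-M j) inc) (subst (λ x → Incident x y) (via-M j') inc'))
    ... | left j  | right j' = ⊥-elim (P-edge-avoids-x₀ j j' inc inc' same)
    ... | right j | left j'  = ⊥-elim (P-edge-avoids-x₀ j' j inc' inc (sym same))

    edge-count-bound : (f : Fin (suc (suc n)) → EdgeId G) → Injective _≡_ _≡_ f → (∀ i → Incident (lookup G (f i)) y) → ⊥
    edge-count-bound f f-inj inc = no-injection (λ i → punchOut (far≢y' i)) λ {i} {j} same →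
      f-inj (far-injective (f i) (f j) (inc i) (inc j) (FP.punchOut-injective (far≢y' i) (far≢y' j) same))
      where
      far≢y' : ∀ i → y ≢ far (f i)
      far≢y' i e = far≢y (f i) (inc i) (sym e)

  degree-bound : (∀ j {y} → Incident (lookup M j) y → ∃[ x ] Missing P y x) →
    ∀ y (f : Fin (suc (suc n)) → EdgeId G) → Injective _≡_ _≡_ f → (∀ i → Incident (lookup G (f i)) y) → ⊥
  degree-bound matched-missing y with FP.any? (λ j → incident? (lookup M j) y)
  ... | yes (j , inc) with matched-missing j inc
  ...   | x₀ , y≢x₀ , no-yx₀ = AtVertex.edge-count-bound y x₀ (λ e → y≢x₀ (sym e)) (λ _ _ → no-yx₀)
  degree-bound matched-missing y | no unmatched =
    AtVertex.edge-count-bound y (punchIn y fzero) (FP.punchInᵢ≢i y fzero) (λ j inc → ⊥-elim (unmatched (j , inc)))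

module Immersion {m : ℕ} (P : SimpleGraph (suc (suc m))) (M : Multigraph (suc (suc m)))
  (M-disjoint : Unique (endpoints M)) (M-proper : All (λ e → proj₁ e ≢ proj₂ e) M)
  (matched-missing : ∀ j {y} → Incident (lookup M j) y → ∃[ x ] Missing P y x)
  (K : KImmersion (edgeList P ++ M) (suc m)) where

  open PlusMatching P M M-disjoint M-proper

  Branch : Set
  Branch = Fin (suc m)

  φ : Branch → V
  φ = KImmersion.φ K

  φ-distinct : ∀ {s t} → s ≢ t → φ s ≢ φ t
  φ-distinct s≢t e = s≢t (KImmersion.φInj K e)

  route : (i j : Branch) → toℕ i < toℕ j → Path G (φ i) (φ j)
  route = KImmersion.route K

  record RouteEdge (s t : Branch) : Set where
    constructor route-edge
    field
      i j  : Branch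
      i<j  : toℕ i < toℕ j
      k    : Fin (Path.len (route i j i<j))
      pair : Link i j s t

  edge-of : ∀ {s t} → RouteEdge s t → EdgeId G
  edge-of a = Path.pe (route (RouteEdge.i a) (RouteEdge.j a) (RouteEdge.i<j a)) (RouteEdge.k a)

  route-edges-disjoint : ∀ {s t s' t'} (a : RouteEdge s t) (b : RouteEdge s' t') → ¬ Link s t s' t' → edge-of a ≢ edge-of b
  route-edges-disjoint {s} {t} a b different =
    KImmersion.disj K (RouteEdge.i a) (RouteEdge.j a) (RouteEdge.i<j a) (RouteEdge.i b) (RouteEdge.j b) (RouteEdge.i<j b)
      (λ { (e₁ , e₂) → different (link-trans (link-sym (subst₂ (λ x y → Link x y s t) e₁ e₂ (RouteEdge.pair a))) (RouteEdge.pair b)) })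
      (RouteEdge.k a) (RouteEdge.k b)

  edge-at : ∀ s t → s ≢ t → Σ (RouteEdge s t) λ a → Incident (lookup G (edge-of a)) (φ t)
  edge-at s t s≢t with FP.<-cmp s t
  ... | tri< s<t _ _ = route-edge s t s<t (proj₁ (last-edge (route s t s<t) (φ-distinct s≢t))) (inj₁ (refl , refl))
                     , proj₂ (last-edge (route s t s<t) (φ-distinct s≢t))
  ... | tri≈ _ s≡t _ = ⊥-elim (s≢t s≡t)
  ... | tri> _ _ t<s = route-edge t s t<s (proj₁ (first-edge (route t s t<s) (φ-distinct (λ e → s≢t (sym e))))) (inj₂ (refl , refl))
                     , proj₂ (first-edge (route t s t<s) (φ-distinct (λ e → s≢t (sym e))))

  -- No route passes through a branch vertex φ t: otherwise φ t meets two
  -- edges of that route and one edge of each of the d - 1 routes from φ t,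
  -- d + 1 distinct edges in all, against the degree bound.
  module ThroughBranch (i j : Branch) (i<j : toℕ i < toℕ j) (I : Interior (route i j i<j))
                       (t : Branch) (φt≡v : φ t ≡ Interior.v I) where
    r : Path G (φ i) (φ j)
    r = route i j i<j

    t∉ij : ∀ s → ¬ Link i j s t
    t∉ij s (inj₁ (_ , j≡t)) = Interior.v≢y I (trans (sym φt≡v) (cong φ (sym j≡t)))
    t∉ij s (inj₂ (i≡t , _)) = Interior.v≢x I (trans (sym φt≡v) (cong φ (sym i≡t)))

    on-r : Fin (Path.len r) → RouteEdge i j
    on-r k = route-edge i j i<j k (inj₁ (refl , refl))

    -- the edges at φ t: the two edges of r, and for each s ≢ t an edge of the route {s,t}
    edge-from : (s : Branch) → Dec (s ≡ t) → EdgeId G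
    edge-from s (yes _)  = Path.pe r (Interior.k₁ I)
    edge-from s (no s≢t) = edge-of (proj₁ (edge-at s t s≢t))

    f : Fin (suc (suc m)) → EdgeId G
    f fzero    = Path.pe r (Interior.k₂ I)
    f (fsuc s) = edge-from s (s FP.≟ t)

    f-at-φt : ∀ a → Incident (lookup G (f a)) (φ t)
    f-at-φt fzero = subst (Incident _) (sym φt≡v) (Interior.k₂-at-v I)
    f-at-φt (fsuc s) with s FP.≟ t
    ... | yes _   = subst (Incident _) (sym φt≡v) (Interior.k₁-at-v I)
    ... | no s≢t  = proj₂ (edge-at s t s≢t)

    f-distinct : ∀ a b → a ≢ b → f a ≢ f b
    f-distinct fzero fzero a≢b = ⊥-elim (a≢b refl)
    f-distinct fzero (fsuc s) _ with s FP.≟ t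
    ... | yes _   = λ e → Interior.k₁≢k₂ I (sym (path-edges-distinct r e))
    ... | no s≢t  = route-edges-disjoint (on-r (Interior.k₂ I)) (proj₁ (edge-at s t s≢t)) (t∉ij s)
    f-distinct (fsuc s) fzero a≢b = λ e → f-distinct fzero (fsuc s) (λ x → a≢b (sym x)) (sym e)
    f-distinct (fsuc s) (fsuc s') a≢b with s FP.≟ t | s' FP.≟ t
    ... | yes s≡t | yes s'≡t = ⊥-elim (a≢b (cong fsuc (trans s≡t (sym s'≡t))))
    ... | yes _   | no s'≢t  = route-edges-disjoint (on-r (Interior.k₁ I)) (proj₁ (edge-at s' t s'≢t)) (t∉ij s')
    ... | no s≢t  | yes _    = route-edges-disjoint (proj₁ (edge-at s t s≢t)) (on-r (Interior.k₁ I)) (λ l → t∉ij s (link-sym l))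
    ... | no s≢t  | no s'≢t  = route-edges-disjoint (proj₁ (edge-at s t s≢t)) (proj₁ (edge-at s' t s'≢t))
            (λ { (inj₁ (s≡s' , _)) → a≢b (cong fsuc s≡s') ; (inj₂ (s≡t , _)) → s≢t s≡t })

    f-injective : Injective _≡_ _≡_ f
    f-injective {a} {b} e with a FP.≟ b
    ... | yes a≡b = a≡b
    ... | no a≢b  = ⊥-elim (f-distinct a b a≢b e)

    impossible : ⊥
    impossible = degree-bound matched-missing (φ t) f f-injective f-at-φt

  IsBranch : V → Set
  IsBranch v = ∃[ t ] φ t ≡ v

  -- There is exactly one non-branch vertex: as φ is injective and |V| = d + 1,
  -- two of them would leave d branch vertices only d - 1 places.
  non-branch-unique : ∀ {y₁ y₂} → ¬ IsBranch y₁ → ¬ IsBranch y₂ → y₁ ≡ y₂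
  non-branch-unique {y₁} {y₂} not₁ not₂ with y₁ FP.≟ y₂
  ... | yes y₁≡y₂ = y₁≡y₂
  ... | no y₁≢y₂  = ⊥-elim (no-injection squeeze (λ e → KImmersion.φInj K
          (FP.punchOut-injective (y₁≢φ _) (y₁≢φ _) (FP.punchOut-injective (y₂'≢ _) (y₂'≢ _) e))))
    where
    y₁≢φ : ∀ t → y₁ ≢ φ t
    y₁≢φ t e = not₁ (t , sym e)
    y₂' : Branch
    y₂' = punchOut y₁≢y₂
    y₂'≢ : ∀ t → y₂' ≢ punchOut (y₁≢φ t)
    y₂'≢ t e = not₂ (t , sym (FP.punchOut-injective y₁≢y₂ (y₁≢φ t) e))
    squeeze : Branch → Fin m
    squeeze t = punchOut (y₂'≢ t)

  non-branch-exists : ∃[ z ] ¬ IsBranch z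
  non-branch-exists = FP.¬∀⟶∃¬ (suc (suc m)) IsBranch (λ v → FP.any? (λ t → φ t FP.≟ v))
    (λ all → no-injection (λ v → proj₁ (all v))
      (λ {a} {b} e → trans (sym (proj₂ (all a))) (trans (cong φ e) (proj₂ (all b)))))

  z : V
  z = proj₁ non-branch-exists

  z-non-branch : ¬ IsBranch z
  z-non-branch = proj₂ non-branch-exists

  branch-or-z : ∀ v → v ≢ z → IsBranch v
  branch-or-z v v≢z with FP.any? (λ t → φ t FP.≟ v)
  ... | yes b = b
  ... | no nb = ⊥-elim (v≢z (non-branch-unique nb z-non-branch))

  interior-is-z : ∀ i j (i<j : toℕ i < toℕ j) (I : Interior (route i j i<j)) → Interior.v I ≡ z
  interior-is-z i j i<j I = non-branch-unique (λ { (t , e) → ThroughBranch.impossible i j i<j I t e }) z-non-branch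

  edge-to-z : ∀ s t → s ≢ t → NoEdge G (φ s) (φ t) → Σ (RouteEdge s t) λ a → Joins (lookup G (edge-of a)) (φ t) z
  edge-to-z s t s≢t no-st with FP.<-cmp s t
  ... | tri< s<t _ _ with interior-before-end (route s t s<t) (φ-distinct s≢t) no-st
  ...   | I , l = route-edge s t s<t (Interior.k₂ I) (inj₁ (refl , refl)) ,
                  subst (Joins _ _) (interior-is-z s t s<t I) (link-swap l)
  edge-to-z s t s≢t no-st | tri≈ _ s≡t _ = ⊥-elim (s≢t s≡t)
  edge-to-z s t s≢t no-st | tri> _ _ t<s
    with interior-after-start (route t s t<s) (φ-distinct (λ e → s≢t (sym e))) (no-edge-sym {G = G} no-st)
  ...   | I , l = route-edge t s t<s (Interior.k₁ I) (inj₂ (refl , refl)) ,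
                  subst (Joins _ _) (interior-is-z t s t<s I) l

  Partner : V → Set
  Partner x = ∃[ j ] Joins (lookup M j) x z

  partner-unique : ∀ {x x'} → Partner x → Partner x' → x ≡ x'
  partner-unique (j , l) (j' , l') = matching-partner M M-disjoint M-proper j j' l l'

  -- A branch vertex non-adjacent in G to two other branch vertices is z's partner:
  -- the two routes give distinct parallel edges from it to z.
  partner-of-z : ∀ s s' t → s ≢ t → s' ≢ t → s ≢ s' → NoEdge G (φ s) (φ t) → NoEdge G (φ s') (φ t) → Partner (φ t)
  partner-of-z s s' t s≢t s'≢t s≢s' no-st no-s't =
    parallel-edges (edge-of (proj₁ from-s)) (edge-of (proj₁ from-s'))
      (route-edges-disjoint (proj₁ from-s) (proj₁ from-s')
        (λ { (inj₁ (s≡s' , _)) → s≢s' s≡s' ; (inj₂ (s≡t , _)) → s≢t s≡t }))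
      (proj₂ from-s) (proj₂ from-s')
    where
    from-s = edge-to-z s t s≢t no-st
    from-s' = edge-to-z s' t s'≢t no-s't

module Gadgets (k : ℕ) (P : SimpleGraph (4 + k)) where

  open SimpleGraphFacts P

  d : ℕ
  d = 3 + k

  nonNeighbours-of-A : ∀ {y} → InA d P y → length (nonNeighbours y) ≡ 3
  nonNeighbours-of-A {y} y∈A = ℕP.+-cancelˡ-≡ (suc k) _ 3
    (trans (cong (_+ length (nonNeighbours y)) (sym y∈A))
      (trans (deg+nonNeighbours y) (ℕP.+-comm 3 (suc k))))

  missing-neighbour : ∀ {y} → InA d P y → ∃[ x ] Missing P y x
  missing-neighbour {y} y∈A with another-member (nonNeighbours y) (nonNeighbours-unique y) (nonNeighbours-nonadjacent y)
                                   (subst (2 ≤_) (sym (nonNeighbours-of-A y∈A)) (s≤s (s≤s z≤n))) y (FP._≟ y)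
  ... | x , x≢y , no-yx = x , (λ e → x≢y (sym e)) , no-yx

  at-most-two-missing : ∀ {y x₁ x₂ x₃} → InA d P y → Missing P y x₁ → Missing P y x₂ → Missing P y x₃ →
    x₁ ≢ x₂ → x₁ ≢ x₃ → x₂ ≢ x₃ → ⊥
  at-most-two-missing {y} {x₁} {x₂} {x₃} y∈A m₁ m₂ m₃ x₁≢x₂ x₁≢x₃ x₂≢x₃ =
    ℕP.<-irrefl refl (subst (4 ≤_) (nonNeighbours-of-A y∈A) (unique-⊆-length distinct missed))
    where
    distinct : Unique (y ∷ x₁ ∷ x₂ ∷ x₃ ∷ [])
    distinct = (proj₁ m₁ ∷ proj₁ m₂ ∷ proj₁ m₃ ∷ []) ∷ (x₁≢x₂ ∷ x₁≢x₃ ∷ []) ∷ (x₂≢x₃ ∷ []) ∷ [] ∷ []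
    missed : All (_∈ nonNeighbours y) (y ∷ x₁ ∷ x₂ ∷ x₃ ∷ [])
    missed = ∈-nonNeighbours y (SimpleGraph.irrefl P y) ∷ ∈-nonNeighbours y (proj₂ m₁)
           ∷ ∈-nonNeighbours y (proj₂ m₂) ∷ ∈-nonNeighbours y (proj₂ m₃) ∷ []

  the-two-missing : ∀ {y x₁ x₂ x} → InA d P y → Missing P y x₁ → Missing P y x₂ → x₁ ≢ x₂ →
    Missing P y x → x ≡ x₁ ⊎ x ≡ x₂
  the-two-missing {x₁ = x₁} {x₂} {x} y∈A m₁ m₂ x₁≢x₂ mx with x FP.≟ x₁ | x FP.≟ x₂
  ... | yes x≡x₁ | _        = inj₁ x≡x₁
  ... | no _     | yes x≡x₂ = inj₂ x≡x₂
  ... | no x≢x₁  | no x≢x₂  = ⊥-elim (at-most-two-missing y∈A m₁ m₂ mx x₁≢x₂ (λ e → x≢x₁ (sym e)) (λ e → x≢x₂ (sym e)))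

  module OnCycle (c : Cycle (4 + k)) (H : MissingOddCycleInA d P c) where
    open CyclicWalk c public

    3≤L : 3 ≤ L
    3≤L = proj₁ H

    walk-in-A : ∀ x → InA d P (walk x)
    walk-in-A x = proj₁ (proj₂ (proj₂ H)) _

    walk-missing : ∀ x → Missing P (walk x) (walk (suc x))
    walk-missing x = proj₂ (proj₂ (proj₂ H)) _ _ (step→cycleEdge x (inj₁ (refl , refl)))

    walk-pred : ∀ j → walk (suc (j + m c)) ≡ walk j
    walk-pred j = trans (cong walk (sym (ℕP.+-suc j (m c)))) (walk-period j)

    cycle-neighbours : ∀ j {u} → Missing P (walk j) u → ∃[ j' ] Link (walk j') (walk (suc j')) (walk j) u
    cycle-neighbours j mu =
      [ (λ u≡next → j , inj₁ (refl , sym u≡next))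
      , (λ u≡previous → j + m c , inj₂ (sym u≡previous , walk-pred j)) ]′
        (the-two-missing (walk-in-A j) (walk-missing j) previous next≢previous mu)
      where
      previous : Missing P (walk j) (walk (j + m c))
      previous = missing-sym (subst (Missing P _) (walk-pred j) (walk-missing (j + m c)))
      next≢previous : walk (suc j) ≢ walk (j + m c)
      next≢previous e = walk-skip 3≤L (j + m c)
        (trans (sym e) (trans (sym (walk-period (suc j))) (cong walk (cong suc (ℕP.+-suc j (m c))))))

  -- Two missing odd cycles in A through a common vertex have the same edges:
  -- walking along the first never leaves the second.
  module TwoCycles (c₁ : Cycle (4 + k)) (H₁ : MissingOddCycleInA d P c₁) (c₂ : Cycle (4 + k)) (H₂ : MissingOddCycleInA d P c₂)
                   (x₁ x₂ : ℕ) (shared : CyclicWalk.walk c₁ x₁ ≡ CyclicWalk.walk c₂ x₂) where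
    module C₁ = OnCycle c₁ H₁
    module C₂ = OnCycle c₂ H₂

    OnC₂ : Fin (4 + k) → Set
    OnC₂ v = ∃[ j ] C₂.walk j ≡ v

    step : ∀ x → OnC₂ (C₁.walk x) → OnC₂ (C₁.walk (suc x))
    step x (j , e) with C₂.cycle-neighbours j (subst (λ v → Missing P v (C₁.walk (suc x))) (sym e) (C₁.walk-missing x))
    ... | j' , inj₁ (_ , e') = suc j' , e'
    ... | j' , inj₂ (e' , _) = j' , e'

    from-shared : ∀ t → OnC₂ (C₁.walk (x₁ + t))
    from-shared zero    = subst (λ y → OnC₂ (C₁.walk y)) (sym (ℕP.+-identityʳ x₁)) (x₂ , sym shared)
    from-shared (suc t) = subst (λ y → OnC₂ (C₁.walk y)) (sym (ℕP.+-suc x₁ t)) (step (x₁ + t) (from-shared t))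

    on-c₂ : ∀ x → OnC₂ (C₁.walk x)
    on-c₂ x = subst OnC₂ around (subst (λ y → OnC₂ (C₁.walk y)) shift (from-shared (x + x₁ * m c₁)))
      where
      shift : x₁ + (x + x₁ * m c₁) ≡ x + x₁ * C₁.L
      shift = trans (sym (ℕP.+-assoc x₁ x (x₁ * m c₁)))
              (trans (cong (_+ x₁ * m c₁) (ℕP.+-comm x₁ x))
              (trans (ℕP.+-assoc x x₁ (x₁ * m c₁)) (cong (x +_) (sym (ℕP.*-suc x₁ (m c₁))))))
      around : C₁.walk (x + x₁ * C₁.L) ≡ C₁.walk x
      around = C₁.walk-mod (x + x₁ * C₁.L) x (DM.[m+kn]%n≡m%n x x₁ C₁.L)

    edges-included : ∀ u w → CycleEdge c₁ u w → CycleEdge c₂ u w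
    edges-included u w e with C₁.cycleEdge→step e
    ... | x , l with on-c₂ x
    ...   | j , on with C₂.cycle-neighbours j (subst (λ v → Missing P v (C₁.walk (suc x))) (sym on) (C₁.walk-missing x))
    ...     | j' , l' = C₂.step→cycleEdge j' (link-trans l' (subst (λ v → Link v (C₁.walk (suc x)) u w) (sym on) l))

  Centre : ∀ {E} → IsGadget d P E → Fin (4 + k) → Set
  Centre (inj₁ (c , _)) v = ∃[ x ] CyclicWalk.walk c x ≡ v
  Centre (inj₂ (_ , a , _)) v = a ≡ v

  same-middle : ∀ {b a b' c c'} → InA d P a → b ≢ b' → c ≢ c' →
    Missing P b a → Missing P a b' → Missing P c a → Missing P a c' →
    ∀ u w → Link b a u w ⊎ Link a b' u w → Link c a u w ⊎ Link a c' u w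
  same-middle a∈A b≢b' c≢c' mba mab' mca mac' u w
    with the-two-missing a∈A (missing-sym mba) mab' b≢b' (missing-sym mca)
       | the-two-missing a∈A (missing-sym mba) mab' b≢b' mac'
  ... | inj₁ refl | inj₂ refl = λ l → l
  ... | inj₂ refl | inj₁ refl = λ { (inj₁ l) → inj₂ (link-flip l) ; (inj₂ l) → inj₁ (link-flip l) }
  ... | inj₁ refl | inj₁ refl = ⊥-elim (c≢c' refl)
  ... | inj₂ refl | inj₂ refl = ⊥-elim (c≢c' refl)

  -- The middle of a missing path is on no missing cycle in A: its two
  -- missing neighbours lie in B, while its cycle neighbour lies in A.
  middle-off-cycle : ∀ {b a b'} (c : Cycle (4 + k)) (H : MissingOddCycleInA d P c) x → CyclicWalk.walk c x ≡ a →
    InB d P b → InB d P b' → b ≢ b' → Missing P b a → Missing P a b' → ⊥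
  middle-off-cycle c H x refl b∈B b'∈B b≢b' mba mab' =
    [ (λ e → b∈B (subst (InA d P) e next-in-A)) , (λ e → b'∈B (subst (InA d P) e next-in-A)) ]′
      (the-two-missing (walk-in-A x) (missing-sym mba) mab' b≢b' (walk-missing x))
    where
    open OnCycle c H
    next-in-A : InA d P (walk (suc x))
    next-in-A = walk-in-A (suc x)

  same-centre : ∀ {E E' v} (g : IsGadget d P E) (g' : IsGadget d P E') → Centre g v → Centre g' v → SameEdgeSet E E'
  same-centre (inj₁ (c , H , s)) (inj₁ (c' , H' , s')) (x , e) (x' , e') =
    same-edge-set s s' (TwoCycles.edges-included c H c' H' x x' (trans e (sym e')))
                       (TwoCycles.edges-included c' H' c H x' x (trans e' (sym e)))
  same-centre (inj₁ (c , H , _)) (inj₂ (_ , _ , _ , b∈B , b'∈B , b≢b' , _ , mba , mab' , _)) (x , e) refl =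
    ⊥-elim (middle-off-cycle c H x e b∈B b'∈B b≢b' mba mab')
  same-centre (inj₂ (_ , _ , _ , b∈B , b'∈B , b≢b' , _ , mba , mab' , _)) (inj₁ (c , H , _)) refl (x , e) =
    ⊥-elim (middle-off-cycle c H x e b∈B b'∈B b≢b' mba mab')
  same-centre (inj₂ (_ , _ , _ , _ , _ , b≢b' , a∈A , mba , mab' , s)) (inj₂ (_ , _ , _ , _ , _ , c≢c' , _ , mca , mac' , s')) refl refl =
    same-edge-set s s' (same-middle a∈A b≢b' c≢c' mba mab' mca mac') (same-middle a∈A c≢c' b≢b' mca mac' mba mab')

-- The immersion argument for the graph P of the theorem and a maximum
-- matching M on A: every gadget has a central vertex which is z or its partner.
-- (Case distinctions here go through local case functions rather than `with`,
-- whose abstraction over this module's large parameters is very expensive.)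

module Centres (k : ℕ) (P : SimpleGraph (4 + k)) (M : Multigraph (4 + k))
  (M-on-A : All (λ e → InA (3 + k) P (proj₁ e) × InA (3 + k) P (proj₂ e) × proj₁ e ≢ proj₂ e) M)
  (M-disjoint : Unique (endpoints M))
  (K : KImmersion (edgeList P ++ M) (3 + k)) where

  open SimpleGraphFacts P
  open Gadgets k P

  M-proper : All (λ e → proj₁ e ≢ proj₂ e) M
  M-proper = All.map (λ e → proj₂ (proj₂ e)) M-on-A

  matched-in-A : ∀ j {y} → Incident (lookup M j) y → InA d P y
  matched-in-A j (inj₁ refl) = proj₁ (lookup-All M-on-A j)
  matched-in-A j (inj₂ refl) = proj₁ (proj₂ (lookup-All M-on-A j))

  open PlusMatching P M M-disjoint M-proper
  open Immersion P M M-disjoint M-proper (λ j inc → missing-neighbour (matched-in-A j inc)) K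

  -- Vertices of B are unmatched, so a missing edge at B is no edge of G.
  no-edge-to-B : ∀ {u b} → InB d P b → Missing P u b → NoEdge G u b
  no-edge-to-B b∈B mub = no-G-edge (proj₂ mub) (λ j l → b∈B (matched-in-A j (link-end₂ l)))

  branch-distinct : ∀ {s t u w} → φ s ≡ u → φ t ≡ w → u ≢ w → s ≢ t
  branch-distinct φs φt u≢w s≡t = u≢w (trans (sym φs) (trans (cong φ s≡t) φt))

  Near : V → Set
  Near v = v ≡ z ⊎ Partner v

  -- A branch vertex missed by a vertex b ∈ B, b ≢ z, is not missed by z ∈ B:
  -- the route from b would reach it from z along an edge of G.
  z-not-missed : ∀ {b t} → InB d P b → InB d P z → b ≢ z → Missing P b (φ t) → Missing P (φ t) z → ⊥
  z-not-missed {b} {t} b∈B z∈B b≢z mbt mtz = from-branch (branch-or-z b b≢z)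
    where
    from-branch : IsBranch b → ⊥
    from-branch (s , φs≡b) = no-edge-to-B z∈B mtz _ (proj₂ (edge-to-z s t (branch-distinct φs≡b refl (proj₁ mbt)) no-st))
      where
      no-st : NoEdge G (φ s) (φ t)
      no-st = subst (λ x → NoEdge G x (φ t)) (sym φs≡b) (no-edge-sym {G = G} (no-edge-to-B b∈B (missing-sym mbt)))

  middle-partner : ∀ {b t b'} → InB d P b → InB d P b' → b ≢ b' → Missing P b (φ t) → Missing P (φ t) b' → Partner (φ t)
  middle-partner {b} {t} {b'} b∈B b'∈B b≢b' mbt mtb' = by-cases (b FP.≟ z) (b' FP.≟ z)
    where
    from-branches : IsBranch b → IsBranch b' → Partner (φ t)
    from-branches (s , φs≡b) (s' , φs'≡b') = partner-of-z s s' t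
      (branch-distinct φs≡b refl (proj₁ mbt)) (branch-distinct φs'≡b' refl (λ e → proj₁ mtb' (sym e)))
      (branch-distinct φs≡b φs'≡b' b≢b')
      (subst (λ x → NoEdge G x (φ t)) (sym φs≡b) (no-edge-sym {G = G} (no-edge-to-B b∈B (missing-sym mbt))))
      (subst (λ x → NoEdge G x (φ t)) (sym φs'≡b') (no-edge-sym {G = G} (no-edge-to-B b'∈B mtb')))
    by-cases : Dec (b ≡ z) → Dec (b' ≡ z) → Partner (φ t)
    by-cases (yes b≡z) _ = ⊥-elim (z-not-missed b'∈B (subst (InB d P) b≡z b∈B) (λ e → b≢b' (trans b≡z (sym e)))
                        (missing-sym mtb') (subst (Missing P (φ t)) b≡z (missing-sym mbt)))
    by-cases _ (yes b'≡z) = ⊥-elim (z-not-missed b∈B (subst (InB d P) b'≡z b'∈B) (λ e → b≢b' (trans e (sym b'≡z)))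
                        mbt (subst (Missing P (φ t)) b'≡z mtb'))
    by-cases (no b≢z) (no b'≢z) = from-branches (branch-or-z b b≢z) (branch-or-z b' b'≢z)

  path-centre : ∀ {b a b'} → InB d P b → InB d P b' → b ≢ b' → Missing P b a → Missing P a b' → Near a
  path-centre {b} {a} {b'} b∈B b'∈B b≢b' mba mab' = by-cases (a FP.≟ z)
    where
    by-cases : Dec (a ≡ z) → Near a
    by-cases (yes a≡z) = inj₁ a≡z
    by-cases (no a≢z)  = inj₂ (from-branch (branch-or-z a a≢z))
      where
      from-branch : IsBranch a → Partner a
      from-branch (t , φt≡a) = subst Partner φt≡a (middle-partner b∈B b'∈B b≢b'
        (subst (Missing P b) (sym φt≡a) mba) (subst (λ x → Missing P x b') (sym φt≡a) mab'))

  -- Otherwise all its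
  -- vertices are branch vertices and no two consecutive steps avoid M (their
  -- middle vertex would be z's partner), while no two consecutive steps lie
  -- in the matching M; so matching steps alternate around an odd cycle.
  module CycleCentre (c : Cycle (4 + k)) (H : MissingOddCycleInA d P c) where
    open OnCycle c H

    Matched : ℕ → Set
    Matched x = ∃[ j ] Joins (lookup M j) (walk x) (walk (suc x))

    matched? : ∀ x → Dec (Matched x)
    matched? x = FP.any? (λ j → link? _ _ (walk x) (walk (suc x)))

    not-both-matched : ∀ x → Matched x → Matched (suc x) → ⊥
    not-both-matched x (j , l) (j' , l') = walk-skip 3≤L x (matching-partner M M-disjoint M-proper j j' l (link-swap l'))

    unmatched-no-edge : ∀ x → ¬ Matched x → NoEdge G (walk x) (walk (suc x))
    unmatched-no-edge x ¬m = no-G-edge (proj₂ (walk-missing x)) (λ j l → ¬m (j , l))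

    unmatched-pair : (∀ x → walk x ≢ z) → ∀ x → ¬ Matched x → ¬ Matched (suc x) → Partner (walk (suc x))
    unmatched-pair off x ¬m ¬m' =
      from-branches (branch-or-z (walk x) (off x)) (branch-or-z (walk (suc x)) (off (suc x)))
                    (branch-or-z (walk (suc (suc x))) (off (suc (suc x))))
      where
      from-branches : IsBranch (walk x) → IsBranch (walk (suc x)) → IsBranch (walk (suc (suc x))) → Partner (walk (suc x))
      from-branches (s , φs) (t , φt) (s' , φs') = subst Partner φt (partner-of-z s s' t
        (branch-distinct φs φt (proj₁ (walk-missing x)))
        (branch-distinct φs' φt (proj₁ (missing-sym (walk-missing (suc x)))))
        (branch-distinct φs φs' (walk-skip 3≤L x))
        (subst₂ (NoEdge G) (sym φs) (sym φt) (unmatched-no-edge x ¬m))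
        (subst₂ (NoEdge G) (sym φs') (sym φt) (no-edge-sym {G = G} (unmatched-no-edge (suc x) ¬m'))))

    unmatched-steps : ∃[ i ] (¬ Matched (toℕ {L} i) × ¬ Matched (suc (toℕ i)))
    unmatched-steps = by-cases (FP.any? (λ i → ¬? (matched? (toℕ i)) ×-dec ¬? (matched? (suc (toℕ i)))))
      where
      by-cases : Dec (∃[ i ] (¬ Matched (toℕ {L} i) × ¬ Matched (suc (toℕ i)))) → ∃[ i ] (¬ Matched (toℕ i) × ¬ Matched (suc (toℕ i)))
      by-cases (yes found)      = found
      by-cases (no alternating) = ⊥-elim (no-odd-alternation matched? L (proj₁ (proj₂ H)) one-of not-both-matched
          (λ { (j , l) → j , subst₂ (Joins _) (walk-period 0) (walk-period 1) l })
          (λ { (j , l) → j , subst₂ (Joins _) (sym (walk-period 0)) (sym (walk-period 1)) l }))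
        where
        one-of : ∀ x → x < L → Matched x ⊎ Matched (suc x)
        one-of x x<L = cases (matched? x) (matched? (suc x))
          where
          cases : Dec (Matched x) → Dec (Matched (suc x)) → Matched x ⊎ Matched (suc x)
          cases (yes m) _        = inj₁ m
          cases (no _)  (yes m') = inj₂ m'
          cases (no ¬m) (no ¬m') = ⊥-elim (alternating (fromℕ< x<L ,
            subst (λ y → ¬ Matched y × ¬ Matched (suc y)) (sym (FP.toℕ-fromℕ< x<L)) (¬m , ¬m')))

    cycle-centre : ∃[ v ] (∃[ x ] walk x ≡ v) × Near v
    cycle-centre = by-cases (FP.any? {n = L} (λ i → walk (toℕ i) FP.≟ z))
      where
      by-cases : Dec (∃[ i ] walk (toℕ {L} i) ≡ z) → ∃[ v ] (∃[ x ] walk x ≡ v) × Near v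
      by-cases (yes (i , e)) = z , (toℕ i , e) , inj₁ refl
      by-cases (no z-off)    = from-steps unmatched-steps
        where
        off : ∀ x → walk x ≢ z
        off x e = z-off (fromℕ< (DM.m%n<n x L) , trans (cong walk (FP.toℕ-fromℕ< (DM.m%n<n x L))) (trans (walk-% x) e))
        from-steps : ∃[ i ] (¬ Matched (toℕ {L} i) × ¬ Matched (suc (toℕ i))) → ∃[ v ] (∃[ x ] walk x ≡ v) × Near v
        from-steps (i , ¬m , ¬m') = walk (suc (toℕ i)) , (suc (toℕ i) , refl) , inj₂ (unmatched-pair off (toℕ i) ¬m ¬m')

  gadget-near-z : ∀ {E} (g : IsGadget d P E) → ∃[ v ] Centre g v × Near v
  gadget-near-z (inj₁ (c , H , _)) = CycleCentre.cycle-centre c H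
  gadget-near-z (inj₂ (_ , a , _ , b∈B , b'∈B , b≢b' , _ , mba , mab' , _)) = a , refl , path-centre b∈B b'∈B b≢b' mba mab'

  -- Only two vertices are near z, so among three such vertices two coincide.
  two-coincide : ∀ {v₁ v₂ v₃} → Near v₁ → Near v₂ → Near v₃ → v₁ ≡ v₂ ⊎ v₁ ≡ v₃ ⊎ v₂ ≡ v₃
  two-coincide (inj₁ e₁) (inj₁ e₂) _         = inj₁ (trans e₁ (sym e₂))
  two-coincide (inj₂ p₁) (inj₂ p₂) _         = inj₁ (partner-unique p₁ p₂)
  two-coincide (inj₁ e₁) (inj₂ _)  (inj₁ e₃) = inj₂ (inj₁ (trans e₁ (sym e₃)))
  two-coincide (inj₁ _)  (inj₂ p₂) (inj₂ p₃) = inj₂ (inj₂ (partner-unique p₂ p₃))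
  two-coincide (inj₂ _)  (inj₁ e₂) (inj₁ e₃) = inj₂ (inj₂ (trans e₂ (sym e₃)))
  two-coincide (inj₂ p₁) (inj₁ _)  (inj₂ p₃) = inj₂ (inj₁ (partner-unique p₁ p₃))

  no-three-gadgets : AtLeastThreeGadgets d P → ⊥
  no-three-gadgets (_ , _ , _ , g₁ , g₂ , g₃ , g₁≉g₂ , g₁≉g₃ , g₂≉g₃) =
    from-centres (gadget-near-z g₁) (gadget-near-z g₂) (gadget-near-z g₃)
    where
    from-centres : ∃[ v ] Centre g₁ v × Near v → ∃[ v ] Centre g₂ v × Near v → ∃[ v ] Centre g₃ v × Near v → ⊥
    from-centres (v₁ , c₁ , near₁) (v₂ , c₂ , near₂) (v₃ , c₃ , near₃) = shared (two-coincide near₁ near₂ near₃)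
      where
      shared : v₁ ≡ v₂ ⊎ v₁ ≡ v₃ ⊎ v₂ ≡ v₃ → ⊥
      shared (inj₁ refl)        = g₁≉g₂ (same-centre g₁ g₂ c₁ c₂)
      shared (inj₂ (inj₁ refl)) = g₁≉g₃ (same-centre g₁ g₃ c₁ c₃)
      shared (inj₂ (inj₂ refl)) = g₂≉g₃ (same-centre g₂ g₃ c₂ c₃)

A-nonempty : ∀ d (P : SimpleGraph (suc d)) → (∃[ v ] deg P v ≡ d ∸ 2) → sizeA d P ≤ 0 → ⊥
A-nonempty d P (v , v∈A) |A|≤0 = ℕP.<-irrefl refl (ℕP.≤-trans (∈⇒nonempty v∈filter) |A|≤0)
  where
  v∈filter : v ∈ filterᵇ (λ v → deg P v ≡ᵇ (d ∸ 2)) (allFin (suc d))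
  v∈filter = MP.∈-filter⁺ (λ v → T? (deg P v ≡ᵇ (d ∸ 2))) (MP.∈-allFin v) (ℕP.≡⇒≡ᵇ _ _ v∈A)

theorem3p8 : (d : ℕ) → 1 ≤ d → (P : SimpleGraph (suc d))
    → (∀ v → d ∸ 2 ≤ deg P v) → (∃[ v ] deg P v ≡ d ∸ 2)
    → sizeA d P ≤ d ∸ 2
    → AtLeastThreeGadgets d P
    → IsDPod d P
theorem3p8 zero ()
theorem3p8 (suc zero)       _ P _ A≢∅ |A|≤0 _ = ⊥-elim (A-nonempty 1 P A≢∅ |A|≤0)
theorem3p8 (suc (suc zero)) _ P _ A≢∅ |A|≤0 _ = ⊥-elim (A-nonempty 2 P A≢∅ |A|≤0)
theorem3p8 (suc (suc (suc k))) _ P min-deg _ |A|≤ three-gadgets =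
  min-deg , |A|≤ , λ M (M-on-A , M-disjoint , _) K → Centres.no-three-gadgets k P M M-on-A M-disjoint K three-gadgets
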